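{- Let $a\ge -1$ be an integer, $\rho$ the largest root of $x^3-ax^2-(a+3)x-1$, and for integers $v,w$ put $\alpha(v,w)=-v-w\rho+(v+1)\rho^2$. Let $v,w$ be integers with $0\le v\le \frac{a-1}{2}$ and $\frac{(2v+1)(a+2)+1}{2}\le w\le (v+1)(a+1)$. Then $2\alpha(v,w)-1$ is totally positive.
   Context: An element of $\mathbb{Q}(\rho)$ is totally positive if all its real conjugates are positive. -}

module Defs where

open import Level using (Level; _⊔_; suc)
open import Data.Nat using (ℕ; zero) renaming (suc to sucℕ)
open import Data.Integer using (ℤ; +_; -[1+_])
open import Data.Product using (Σ; _×_)
open import Data.Sum using (_⊎_)
open import Relation.Nullary using (¬_)
open import Algebra.Bundles using (CommutativeRing)

record OrderedField (c ℓ₁ ℓ₂ : Level) : Set (suc (c ⊔ ℓ₁ ⊔ ℓ₂)) where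
  field
    commutativeRing : CommutativeRing c ℓ₁
  open CommutativeRing commutativeRing public
  infix 4 _<_
  field
    _<_        : Carrier → Carrier → Set ℓ₂
    <-irrefl   : ∀ {x y} → x ≈ y → ¬ (x < y)
    <-trans    : ∀ {x y z} → x < y → y < z → x < z
    <-resp-≈   : ∀ {x x' y y'} → x ≈ x' → y ≈ y' → x < y → x' < y'
    <-trichot  : ∀ x y → x < y ⊎ (x ≈ y ⊎ y < x)
    +-mono-<   : ∀ {x y} z → x < y → x + z < y + z
    *-pos      : ∀ {x y} → 0# < x → 0# < y → 0# < x * y
    0≉1        : ¬ (0# ≈ 1#)
    inverse    : ∀ x → ¬ (x ≈ 0#) → Σ Carrier (λ y → x * y ≈ 1#)

module _ {c ℓ₁ ℓ₂} (F : OrderedField c ℓ₁ ℓ₂) where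
  open OrderedField F

  fromℕ : ℕ → Carrier
  fromℕ zero     = 0#
  fromℕ (sucℕ n) = 1# + fromℕ n

  fromℤ : ℤ → Carrier
  fromℤ (+ n)      = fromℕ n
  fromℤ -[1+ n ]   = - fromℕ (sucℕ n)

  fPoly : ℤ → Carrier → Carrier
  fPoly a x = x * x * x - fromℤ a * (x * x) - (fromℤ a + fromℤ (+ 3)) * x - 1#

  αAt : ℤ → ℤ → Carrier → Carrier
  αAt v w x = - fromℤ v - fromℤ w * x + (fromℤ v + 1#) * (x * x)

  twoαMinus1 : ℤ → ℤ → Carrier → Carrier
  twoαMinus1 v w x = (αAt v w x + αAt v w x) - 1#

-- Let r be a root of f = x³ - a x² - (a+3) x - 1 in any ordered field; r ≠ 0 as f(0) = -1.
-- Dividing f by x + 1 gives f = (x+1) p - x = (x+1) q + x² with p = x² - (a+1) x - 1 and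
-- q = x² - (a+2) x - 1. Writing K = (v+1)(a+1) - w, L = 2w - (2v+1)(a+2) - 1 and
-- M = a - 1 - 2v, all nonnegative by hypothesis:
--   r > 0:          (1+r) p(r) = r, so p(r) > 0, and 2α - 1 = 2(v+1) p(r) + 1 + 2rK.
--   r < 0, q(r) ≥ 0: 2α - 1 = (2v+1) q(r) + r² - r - rL.
--   r < 0, q(r) < 0: (1+r)(-q(r)) = r² gives r > -1; then e = r² - r + a q(r) satisfies
--                   (1+r) e = -r (-q(r) - 2r) > 0, and 2α - 1 = e - M q(r) - rL.
-- In every case 2α - 1 is a sum of nonnegative terms, one of them positive.
module Submission where

open import Defs
open import Level using (Level)
open import Data.Nat as ℕ using (ℕ; zero; suc)
import Data.Nat.Properties as ℕP
open import Data.Integer as ℤ using (ℤ; +_; -[1+_]; _⊖_; sign; ∣_∣; _◃_)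
import Data.Integer.Properties as ℤP
open import Data.Sign as Sign using (Sign)
open import Data.Sum using (_⊎_; inj₁; inj₂)
open import Data.Empty using (⊥-elim)
open import Data.Maybe using (Maybe; just; nothing)
open import Relation.Nullary using (¬_; yes; no)
open import Relation.Binary.PropositionalEquality as ≡ using (_≡_)
import Algebra.Properties.Ring as RingProperties
import Algebra.Properties.Semiring.Mult as SemiringMult
import Algebra.Properties.CommutativeSemigroup as CommutativeSemigroupProperties
import Algebra.Solver.Ring.AlmostCommutativeRing as AlmostCommutativeRing
import Relation.Binary.Reasoning.Setoid as SetoidReasoning

module OrderedFieldProperties {c ℓ₁ ℓ₂} (F : OrderedField c ℓ₁ ℓ₂) where
  open OrderedField F
  open RingProperties ring using (-1*x≈-x; -‿distribʳ-*; -‿involutive)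
  open SetoidReasoning setoid

  infix 4 _≤_
  _≤_ : Carrier → Carrier → Set _
  x ≤ y = x < y ⊎ x ≈ y

  <-respʳ-≈ : ∀ {x y y′} → y ≈ y′ → x < y → x < y′
  <-respʳ-≈ = <-resp-≈ refl

  <-≤-trans : ∀ {x y z} → x < y → y ≤ z → x < z
  <-≤-trans x<y (inj₁ y<z) = <-trans x<y y<z
  <-≤-trans x<y (inj₂ y≈z) = <-respʳ-≈ y≈z x<y

  ≤-resp-≈ : ∀ {x x′ y y′} → x ≈ x′ → y ≈ y′ → x ≤ y → x′ ≤ y′
  ≤-resp-≈ x≈x′ y≈y′ (inj₁ x<y) = inj₁ (<-resp-≈ x≈x′ y≈y′ x<y)
  ≤-resp-≈ x≈x′ y≈y′ (inj₂ x≈y) = inj₂ (trans (sym x≈x′) (trans x≈y y≈y′))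

  x<y⇒0<y-x : ∀ {x y} → x < y → 0# < y - x
  x<y⇒0<y-x {x} x<y = <-resp-≈ (-‿inverseʳ x) refl (+-mono-< (- x) x<y)

  x≤y⇒0≤y-x : ∀ {x y} → x ≤ y → 0# ≤ y - x
  x≤y⇒0≤y-x         (inj₁ x<y) = inj₁ (x<y⇒0<y-x x<y)
  x≤y⇒0≤y-x {x} {y} (inj₂ x≈y) = inj₂ (begin
    0#     ≈⟨ -‿inverseʳ y ⟨
    y - y  ≈⟨ +-congˡ (-‿cong x≈y) ⟨
    y - x  ∎)

  y-x+x≈y : ∀ x y → y - x + x ≈ y
  y-x+x≈y x y = begin
    y - x + x     ≈⟨ +-assoc y (- x) x ⟩
    y + (- x + x) ≈⟨ +-congˡ (-‿inverseˡ x) ⟩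
    y + 0#        ≈⟨ +-identityʳ y ⟩
    y             ∎

  0≤y-x⇒x≤y : ∀ {x y} → 0# ≤ y - x → x ≤ y
  0≤y-x⇒x≤y {x} {y} (inj₁ 0<y-x) =
    inj₁ (<-resp-≈ (+-identityˡ x) (y-x+x≈y x y) (+-mono-< x 0<y-x))
  0≤y-x⇒x≤y {x} {y} (inj₂ 0≈y-x) = inj₂ (begin
    x          ≈⟨ +-identityˡ x ⟨
    0# + x     ≈⟨ +-congʳ 0≈y-x ⟩
    y - x + x  ≈⟨ y-x+x≈y x y ⟩
    y          ∎)

  x<0⇒0<-x : ∀ {x} → x < 0# → 0# < - x
  x<0⇒0<-x {x} x<0 = <-resp-≈ (-‿inverseʳ x) (+-identityˡ (- x)) (+-mono-< (- x) x<0)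

  0≤x⊎0<-x : ∀ x → 0# ≤ x ⊎ 0# < - x
  0≤x⊎0<-x x with <-trichot 0# x
  ... | inj₁ 0<x         = inj₁ (inj₁ 0<x)
  ... | inj₂ (inj₁ 0≈x)  = inj₁ (inj₂ 0≈x)
  ... | inj₂ (inj₂ x<0)  = inj₂ (x<0⇒0<-x x<0)

  x≤x+y : ∀ {x y} → 0# ≤ y → x ≤ x + y
  x≤x+y {x} {y} (inj₁ 0<y) = inj₁ (<-resp-≈ (+-identityˡ x) (+-comm y x) (+-mono-< x 0<y))
  x≤x+y {x} {y} (inj₂ 0≈y) = inj₂ (trans (sym (+-identityʳ x)) (+-congˡ 0≈y))

  +-pos-nonneg : ∀ {x y} → 0# < x → 0# ≤ y → 0# < x + y
  +-pos-nonneg 0<x 0≤y = <-≤-trans 0<x (x≤x+y 0≤y)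

  +-nonneg-pos : ∀ {x y} → 0# ≤ x → 0# < y → 0# < x + y
  +-nonneg-pos {x} {y} 0≤x 0<y = <-respʳ-≈ (+-comm y x) (+-pos-nonneg 0<y 0≤x)

  +-pos : ∀ {x y} → 0# < x → 0# < y → 0# < x + y
  +-pos 0<x 0<y = +-pos-nonneg 0<x (inj₁ 0<y)

  *-nonneg : ∀ {x y} → 0# ≤ x → 0# ≤ y → 0# ≤ x * y
  *-nonneg         (inj₁ 0<x) (inj₁ 0<y) = inj₁ (*-pos 0<x 0<y)
  *-nonneg {x}     _          (inj₂ 0≈y) = inj₂ (trans (sym (zeroʳ x)) (*-congˡ 0≈y))
  *-nonneg {_} {y} (inj₂ 0≈x) (inj₁ _)   = inj₂ (trans (sym (zeroˡ y)) (*-congʳ 0≈x))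

  *-cancelˡ-pos : ∀ {x y} → 0# < x → 0# < x * y → 0# < y
  *-cancelˡ-pos {x} {y} 0<x 0<xy with <-trichot 0# y
  ... | inj₁ 0<y        = 0<y
  ... | inj₂ (inj₁ 0≈y) = ⊥-elim (<-irrefl (trans (sym (zeroʳ x)) (*-congˡ 0≈y)) 0<xy)
  ... | inj₂ (inj₂ y<0) = ⊥-elim (<-irrefl (sym (-‿inverseʳ (x * y))) (+-pos 0<xy 0<-xy))
    where
    0<-xy : 0# < - (x * y)
    0<-xy = <-respʳ-≈ (sym (-‿distribʳ-* x y)) (*-pos 0<x (x<0⇒0<-x y<0))

  -1*-1≈1 : - 1# * - 1# ≈ 1#
  -1*-1≈1 = trans (-1*x≈-x (- 1#)) (-‿involutive 1#)

  0<1 : 0# < 1#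
  0<1 with <-trichot 0# 1#
  ... | inj₁ 0<1        = 0<1
  ... | inj₂ (inj₁ 0≈1) = ⊥-elim (0≉1 0≈1)
  ... | inj₂ (inj₂ 1<0) = ⊥-elim (<-irrefl refl (<-trans 1<0 0<[-1]*[-1]))
    where
    0<[-1]*[-1] : 0# < 1#
    0<[-1]*[-1] = <-respʳ-≈ -1*-1≈1 (*-pos (x<0⇒0<-x 1<0) (x<0⇒0<-x 1<0))

  0≤fromℕ : ∀ n → 0# ≤ fromℕ F n
  0≤fromℕ zero    = inj₂ refl
  0≤fromℕ (suc n) = inj₁ (+-pos-nonneg 0<1 (0≤fromℕ n))

module IntegerEmbedding {c ℓ₁ ℓ₂} (F : OrderedField c ℓ₁ ℓ₂) where
  open OrderedField F
  open OrderedFieldProperties F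
  open RingProperties ring using (-0#≈0#; -1*x≈-x; -‿involutive; -‿+-comm)
  open SemiringMult semiring using (_×_; ×-homo-+; ×1-homo-*)
  open CommutativeSemigroupProperties +-commutativeSemigroup using () renaming (interchange to +-interchange)
  open CommutativeSemigroupProperties *-commutativeSemigroup using () renaming (interchange to *-interchange)
  open SetoidReasoning setoid

  ι : ℤ → Carrier
  ι = fromℤ F

  fromℕ≡×1# : ∀ n → fromℕ F n ≡ n × 1#
  fromℕ≡×1# zero    = ≡.refl
  fromℕ≡×1# (suc n) = ≡.cong (_+_ 1#) (fromℕ≡×1# n)

  fromℕ-+ : ∀ m n → fromℕ F (m ℕ.+ n) ≈ fromℕ F m + fromℕ F n
  fromℕ-+ m n = begin
    fromℕ F (m ℕ.+ n)          ≡⟨ fromℕ≡×1# (m ℕ.+ n) ⟩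
    (m ℕ.+ n) × 1#             ≈⟨ ×-homo-+ 1# m n ⟩
    m × 1# + n × 1#            ≡⟨ ≡.cong₂ _+_ (fromℕ≡×1# m) (fromℕ≡×1# n) ⟨
    fromℕ F m + fromℕ F n      ∎

  fromℕ-* : ∀ m n → fromℕ F (m ℕ.* n) ≈ fromℕ F m * fromℕ F n
  fromℕ-* m n = begin
    fromℕ F (m ℕ.* n)          ≡⟨ fromℕ≡×1# (m ℕ.* n) ⟩
    (m ℕ.* n) × 1#             ≈⟨ ×1-homo-* m n ⟩
    m × 1# * n × 1#            ≡⟨ ≡.cong₂ _*_ (fromℕ≡×1# m) (fromℕ≡×1# n) ⟨
    fromℕ F m * fromℕ F n      ∎

  [1+x]-[1+y]≈x-y : ∀ x y → (1# + x) - (1# + y) ≈ x - y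
  [1+x]-[1+y]≈x-y x y = begin
    (1# + x) - (1# + y)        ≈⟨ +-congˡ (-‿+-comm 1# y) ⟨
    (1# + x) + (- 1# + - y)    ≈⟨ +-interchange 1# x (- 1#) (- y) ⟩
    (1# - 1#) + (x - y)        ≈⟨ +-congʳ (-‿inverseʳ 1#) ⟩
    0# + (x - y)               ≈⟨ +-identityˡ (x - y) ⟩
    x - y                      ∎

  ι-⊖ : ∀ m n → ι (m ⊖ n) ≈ fromℕ F m - fromℕ F n
  ι-⊖ m       zero    = sym (trans (+-congˡ -0#≈0#) (+-identityʳ (fromℕ F m)))
  ι-⊖ zero    (suc n) = sym (+-identityˡ _)
  ι-⊖ (suc m) (suc n) = begin
    ι (suc m ⊖ suc n)                    ≡⟨ ≡.cong ι (ℤP.[1+m]⊖[1+n]≡m⊖n m n) ⟩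
    ι (m ⊖ n)                            ≈⟨ ι-⊖ m n ⟩
    fromℕ F m - fromℕ F n                ≈⟨ [1+x]-[1+y]≈x-y (fromℕ F m) (fromℕ F n) ⟨
    fromℕ F (suc m) - fromℕ F (suc n)    ∎

  ι-+ : ∀ i j → ι (i ℤ.+ j) ≈ ι i + ι j
  ι-+ (+ m)    (+ n)    = fromℕ-+ m n
  ι-+ (+ m)    -[1+ n ] = ι-⊖ m (suc n)
  ι-+ -[1+ m ] (+ n)    = trans (ι-⊖ n (suc m)) (+-comm _ _)
  ι-+ -[1+ m ] -[1+ n ] = begin
    - fromℕ F (suc (suc (m ℕ.+ n)))      ≡⟨ ≡.cong (λ k → - fromℕ F (suc k)) (ℕP.+-suc m n) ⟨
    - fromℕ F (suc m ℕ.+ suc n)          ≈⟨ -‿cong (fromℕ-+ (suc m) (suc n)) ⟩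
    - (fromℕ F (suc m) + fromℕ F (suc n)) ≈⟨ -‿+-comm _ _ ⟨
    ι -[1+ m ] + ι -[1+ n ]              ∎

  ι-neg : ∀ i → ι (ℤ.- i) ≈ - ι i
  ι-neg (+ zero)  = sym -0#≈0#
  ι-neg (+ suc n) = refl
  ι-neg -[1+ n ]  = sym (-‿involutive _)

  ι-- : ∀ i j → ι (i ℤ.- j) ≈ ι i - ι j
  ι-- i j = trans (ι-+ i (ℤ.- j)) (+-congˡ (ι-neg j))

  ι-1 : ι (+ 1) ≈ 1#
  ι-1 = +-identityʳ 1#

  ι-+1 : ∀ i → ι (i ℤ.+ + 1) ≈ ι i + 1#
  ι-+1 i = trans (ι-+ i (+ 1)) (+-congˡ ι-1)

  σ : Sign → Carrier
  σ Sign.+ = 1#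
  σ Sign.- = - 1#

  σ-* : ∀ s t → σ (s Sign.* t) ≈ σ s * σ t
  σ-* Sign.+ Sign.+ = sym (*-identityˡ _)
  σ-* Sign.+ Sign.- = sym (*-identityˡ _)
  σ-* Sign.- Sign.+ = sym (*-identityʳ _)
  σ-* Sign.- Sign.- = sym -1*-1≈1

  ι-◃ : ∀ s n → ι (s ◃ n) ≈ σ s * fromℕ F n
  ι-◃ s      zero    = sym (zeroʳ _)
  ι-◃ Sign.+ (suc n) = sym (*-identityˡ _)
  ι-◃ Sign.- (suc n) = sym (-1*x≈-x _)

  ι-* : ∀ i j → ι (i ℤ.* j) ≈ ι i * ι j
  ι-* i j = begin
    ι (sign i Sign.* sign j ◃ ∣ i ∣ ℕ.* ∣ j ∣)                 ≈⟨ ι-◃ (sign i Sign.* sign j) (∣ i ∣ ℕ.* ∣ j ∣) ⟩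
    σ (sign i Sign.* sign j) * fromℕ F (∣ i ∣ ℕ.* ∣ j ∣)      ≈⟨ *-cong (σ-* (sign i) (sign j)) (fromℕ-* ∣ i ∣ ∣ j ∣) ⟩
    (σ (sign i) * σ (sign j)) * (fromℕ F ∣ i ∣ * fromℕ F ∣ j ∣) ≈⟨ *-interchange _ _ _ _ ⟩
    (σ (sign i) * fromℕ F ∣ i ∣) * (σ (sign j) * fromℕ F ∣ j ∣) ≈⟨ *-cong (ι-◃ (sign i) ∣ i ∣) (ι-◃ (sign j) ∣ j ∣) ⟨
    ι (sign i ◃ ∣ i ∣) * ι (sign j ◃ ∣ j ∣)                    ≡⟨ ≡.cong₂ (λ k l → ι k * ι l) (ℤP.◃-inverse i) (ℤP.◃-inverse j) ⟩
    ι i * ι j                                                   ∎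

  0≤ι : ∀ {i} → + 0 ℤ.≤ i → 0# ≤ ι i
  0≤ι {+ n} _ = 0≤fromℕ n

  ι-mono : ∀ {i j} → i ℤ.≤ j → ι i ≤ ι j
  ι-mono {i} {j} i≤j = 0≤y-x⇒x≤y (≤-resp-≈ refl (ι-- j i) (0≤ι (ℤP.i≤j⇒0≤j-i i≤j)))

module IntegerCoefficientSolver {c ℓ₁ ℓ₂} (F : OrderedField c ℓ₁ ℓ₂) where
  open OrderedField F
  open IntegerEmbedding F using (ι; ι-+; ι-*; ι-neg; ι-1)

  -- Coefficient map for the ring solver: it agrees with ι but sends 1 to 1# on the nose,
  -- so that identities proved by the solver can be stated with 1#.
  literal : ℤ → Carrier
  literal (+ 1) = 1#
  literal i     = ι i

  literal≈ι : ∀ i → literal i ≈ ι i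
  literal≈ι (+ 0)           = refl
  literal≈ι (+ 1)           = sym ι-1
  literal≈ι (+ suc (suc n)) = refl
  literal≈ι -[1+ n ]        = refl

  literal-morphism : ℤ.+-*-rawRing AlmostCommutativeRing.-Raw-AlmostCommutative⟶
                       AlmostCommutativeRing.fromCommutativeRing commutativeRing
  literal-morphism = record
    { ⟦_⟧    = literal
    ; +-homo = λ i j → trans (literal≈ι (i ℤ.+ j)) (trans (ι-+ i j) (sym (+-cong (literal≈ι i) (literal≈ι j))))
    ; *-homo = λ i j → trans (literal≈ι (i ℤ.* j)) (trans (ι-* i j) (sym (*-cong (literal≈ι i) (literal≈ι j))))
    ; -‿homo = λ i → trans (literal≈ι (ℤ.- i)) (trans (ι-neg i) (sym (-‿cong (literal≈ι i))))
    ; 0-homo = refl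
    ; 1-homo = refl
    }

  literal-≟ : ∀ i j → Maybe (literal i ≈ literal j)
  literal-≟ i j with i ℤ.≟ j
  ... | yes ≡.refl = just refl
  ... | no _       = nothing

  open import Algebra.Solver.Ring ℤ.+-*-rawRing
    (AlmostCommutativeRing.fromCommutativeRing commutativeRing) literal-morphism literal-≟ public

module Proposition {c ℓ₁ ℓ₂} (F : OrderedField c ℓ₁ ℓ₂) where
  open OrderedField F
  open OrderedFieldProperties F
  open IntegerEmbedding F using (ι; ι-mono; ι-*; ι-+; ι--; ι-1; ι-+1)
  open IntegerCoefficientSolver F using (Polynomial; solve; _:=_; con; _:+_; _:-_; _:*_; :-_)
  open RingProperties ring using (-0#≈0#)
  open SetoidReasoning setoid

  2# 3# : Carrier
  2# = fromℕ F 2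
  3# = fromℕ F 3

  -- cubic (ι a) and 2α-1 (ι v) (ι w) are fPoly F a and twoαMinus1 F v w by definition.
  cubic : Carrier → Carrier → Carrier
  cubic A x = x * x * x - A * (x * x) - (A + 3#) * x - 1#

  α : Carrier → Carrier → Carrier → Carrier
  α V W x = - V - W * x + (V + 1#) * (x * x)

  2α-1 : Carrier → Carrier → Carrier → Carrier
  2α-1 V W x = α V W x + α V W x - 1#

  p q e : Carrier → Carrier → Carrier
  p A x = x * x - (A + 1#) * x - 1#
  q A x = x * x - (A + 2#) * x - 1#
  e A x = x * x - x + A * q A x

  -- Solver syntax whose denotations are the definitions above on the nose.
  module _ {n : ℕ} where
    1ₑ 2ₑ 3ₑ : Polynomial n
    1ₑ = con (+ 1)
    2ₑ = con (+ 2)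
    3ₑ = con (+ 3)

    cubicₑ pₑ qₑ eₑ : Polynomial n → Polynomial n → Polynomial n
    cubicₑ A x = x :* x :* x :- A :* (x :* x) :- (A :+ 3ₑ) :* x :- 1ₑ
    pₑ A x = x :* x :- (A :+ 1ₑ) :* x :- 1ₑ
    qₑ A x = x :* x :- (A :+ 2ₑ) :* x :- 1ₑ
    eₑ A x = x :* x :- x :+ A :* qₑ A x

    αₑ 2α-1ₑ : Polynomial n → Polynomial n → Polynomial n → Polynomial n
    αₑ V W x = :- V :- W :* x :+ (V :+ 1ₑ) :* (x :* x)
    2α-1ₑ V W x = αₑ V W x :+ αₑ V W x :- 1ₑ

  [1+x]*p≈x+cubic : ∀ A x → (1# + x) * p A x ≈ x + cubic A x
  [1+x]*p≈x+cubic = solve 2 (λ A x → (1ₑ :+ x) :* pₑ A x := x :+ cubicₑ A x) refl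

  -q*[1+x]≈[-x]²-cubic : ∀ A x → - q A x * (1# + x) ≈ - x * - x - cubic A x
  -q*[1+x]≈[-x]²-cubic = solve 2 (λ A x → :- qₑ A x :* (1ₑ :+ x) := :- x :* :- x :- cubicₑ A x) refl

  [1+x]*e≈A*cubic+[-x]*[-q-2x] : ∀ A x → (1# + x) * e A x ≈ A * cubic A x + - x * (- q A x - x - x)
  [1+x]*e≈A*cubic+[-x]*[-q-2x] = solve 2 (λ A x →
    (1ₑ :+ x) :* eₑ A x := A :* cubicₑ A x :+ :- x :* (:- qₑ A x :- x :- x)) refl

  1≈x*[x²-Ax-A-3]-cubic : ∀ A x → 1# ≈ x * (x * x - A * x - (A + 3#)) - cubic A x
  1≈x*[x²-Ax-A-3]-cubic = solve 2 (λ A x → 1ₑ := x :* (x :* x :- A :* x :- (A :+ 3ₑ)) :- cubicₑ A x) refl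

  2α-1≈[via-p] : ∀ A V W x →
    2α-1 V W x ≈ 2# * ((V + 1#) * p A x) + 1# + 2# * (x * ((V + 1#) * (A + 1#) - W))
  2α-1≈[via-p] = solve 4 (λ A V W x →
    2α-1ₑ V W x := 2ₑ :* ((V :+ 1ₑ) :* pₑ A x) :+ 1ₑ :+ 2ₑ :* (x :* ((V :+ 1ₑ) :* (A :+ 1ₑ) :- W))) refl

  2α-1≈[via-q] : ∀ A V W x →
    2α-1 V W x ≈ (2# * V + 1#) * q A x + - x * - x + - x + - x * (2# * W - ((2# * V + 1#) * (A + 2#) + 1#))
  2α-1≈[via-q] = solve 4 (λ A V W x →
    2α-1ₑ V W x := (2ₑ :* V :+ 1ₑ) :* qₑ A x :+ :- x :* :- x :+ :- x
                   :+ :- x :* (2ₑ :* W :- ((2ₑ :* V :+ 1ₑ) :* (A :+ 2ₑ) :+ 1ₑ))) refl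

  2α-1≈[via-e] : ∀ A V W x →
    2α-1 V W x ≈ e A x + (A - 1# - 2# * V) * - q A x + - x * (2# * W - ((2# * V + 1#) * (A + 2#) + 1#))
  2α-1≈[via-e] = solve 4 (λ A V W x →
    2α-1ₑ V W x := eₑ A x :+ (A :- 1ₑ :- 2ₑ :* V) :* :- qₑ A x
                   :+ :- x :* (2ₑ :* W :- ((2ₑ :* V :+ 1ₑ) :* (A :+ 2ₑ) :+ 1ₑ))) refl

  module _ {A r : Carrier} (root : cubic A r ≈ 0#) where

    x-cubic≈x : ∀ x → x - cubic A r ≈ x
    x-cubic≈x x = trans (+-congˡ (trans (-‿cong root) -0#≈0#)) (+-identityʳ x)

    root≉0 : ¬ (r ≈ 0#)
    root≉0 r≈0 = 0≉1 (sym (begin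
      1#                                          ≈⟨ 1≈x*[x²-Ax-A-3]-cubic A r ⟩
      r * (r * r - A * r - (A + 3#)) - cubic A r  ≈⟨ x-cubic≈x _ ⟩
      r * (r * r - A * r - (A + 3#))              ≈⟨ *-congʳ r≈0 ⟩
      0# * (r * r - A * r - (A + 3#))             ≈⟨ zeroˡ _ ⟩
      0#                                          ∎))

    0<root⇒0<p : 0# < r → 0# < p A r
    0<root⇒0<p 0<r = *-cancelˡ-pos (+-pos 0<1 0<r) (<-respʳ-≈ (sym [1+r]*p≈r) 0<r)
      where
      [1+r]*p≈r : (1# + r) * p A r ≈ r
      [1+r]*p≈r = trans ([1+x]*p≈x+cubic A r) (trans (+-congˡ root) (+-identityʳ r))

    module _ (0<-r : 0# < - r) (0<-q : 0# < - q A r) where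

      -1<root : 0# < 1# + r
      -1<root = *-cancelˡ-pos 0<-q (<-respʳ-≈ (sym -q*[1+r]≈[-r]²) (*-pos 0<-r 0<-r))
        where
        -q*[1+r]≈[-r]² : - q A r * (1# + r) ≈ - r * - r
        -q*[1+r]≈[-r]² = trans (-q*[1+x]≈[-x]²-cubic A r) (x-cubic≈x _)

      0<e : 0# < e A r
      0<e = *-cancelˡ-pos -1<root (<-respʳ-≈ (sym [1+r]*e≈[-r]*[-q-2r]) 0<[-r]*[-q-2r])
        where
        [1+r]*e≈[-r]*[-q-2r] : (1# + r) * e A r ≈ - r * (- q A r - r - r)
        [1+r]*e≈[-r]*[-q-2r] = begin
          (1# + r) * e A r                           ≈⟨ [1+x]*e≈A*cubic+[-x]*[-q-2x] A r ⟩
          A * cubic A r + - r * (- q A r - r - r)    ≈⟨ +-congʳ (trans (*-congˡ root) (zeroʳ A)) ⟩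
          0# + - r * (- q A r - r - r)               ≈⟨ +-identityˡ _ ⟩
          - r * (- q A r - r - r)                    ∎
        0<[-r]*[-q-2r] : 0# < - r * (- q A r - r - r)
        0<[-r]*[-q-2r] = *-pos 0<-r (+-pos (+-pos 0<-q 0<-r) 0<-r)

  module _ {A V W : Carrier}
           (0≤V : 0# ≤ V) (2V≤A-1 : 2# * V ≤ A - 1#)
           (lower : (2# * V + 1#) * (A + 2#) + 1# ≤ 2# * W)
           (upper : W ≤ (V + 1#) * (A + 1#)) where

    0≤2 : 0# ≤ 2#
    0≤2 = 0≤fromℕ 2

    0<V+1 : 0# < V + 1#
    0<V+1 = +-nonneg-pos 0≤V 0<1

    0<2V+1 : 0# < 2# * V + 1#
    0<2V+1 = +-nonneg-pos (*-nonneg 0≤2 0≤V) 0<1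

    2α-1-pos-at-positive-root : ∀ {r} → cubic A r ≈ 0# → 0# < r → 0# < 2α-1 V W r
    2α-1-pos-at-positive-root {r} root 0<r = <-respʳ-≈ (sym (2α-1≈[via-p] A V W r))
      (+-pos-nonneg (+-nonneg-pos (*-nonneg 0≤2 (inj₁ (*-pos 0<V+1 (0<root⇒0<p root 0<r)))) 0<1)
                    (*-nonneg 0≤2 (*-nonneg (inj₁ 0<r) (x≤y⇒0≤y-x upper))))

    2α-1-pos-at-negative-root : ∀ {r} → cubic A r ≈ 0# → 0# < - r → 0# < 2α-1 V W r
    2α-1-pos-at-negative-root {r} root 0<-r with 0≤x⊎0<-x (q A r)
    ... | inj₁ 0≤q = <-respʳ-≈ (sym (2α-1≈[via-q] A V W r))
      (+-pos-nonneg (+-pos (+-nonneg-pos (*-nonneg (inj₁ 0<2V+1) 0≤q) (*-pos 0<-r 0<-r)) 0<-r)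
                    (*-nonneg (inj₁ 0<-r) (x≤y⇒0≤y-x lower)))
    ... | inj₂ 0<-q = <-respʳ-≈ (sym (2α-1≈[via-e] A V W r))
      (+-pos-nonneg (+-pos-nonneg (0<e root 0<-r 0<-q) (*-nonneg (x≤y⇒0≤y-x 2V≤A-1) (inj₁ 0<-q)))
                    (*-nonneg (inj₁ 0<-r) (x≤y⇒0≤y-x lower)))

    2α-1-pos : ∀ {r} → cubic A r ≈ 0# → 0# < 2α-1 V W r
    2α-1-pos {r} root with <-trichot 0# r
    ... | inj₁ 0<r        = 2α-1-pos-at-positive-root root 0<r
    ... | inj₂ (inj₁ 0≈r) = ⊥-elim (root≉0 root (sym 0≈r))
    ... | inj₂ (inj₂ r<0) = 2α-1-pos-at-negative-root root (x<0⇒0<-x r<0)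

  2α-1-pos-ℤ : ∀ a v w → + 0 ℤ.≤ v → + 2 ℤ.* v ℤ.≤ a ℤ.- + 1 →
    (+ 2 ℤ.* v ℤ.+ + 1) ℤ.* (a ℤ.+ + 2) ℤ.+ + 1 ℤ.≤ + 2 ℤ.* w →
    w ℤ.≤ (v ℤ.+ + 1) ℤ.* (a ℤ.+ + 1) →
    ∀ {r} → fPoly F a r ≈ 0# → 0# < twoαMinus1 F v w r
  2α-1-pos-ℤ a v w 0≤v 2v≤a-1 lower upper = 2α-1-pos
    (ι-mono 0≤v)
    (≤-resp-≈ (ι-* (+ 2) v) (trans (ι-- a (+ 1)) (+-congˡ (-‿cong ι-1))) (ι-mono 2v≤a-1))
    (≤-resp-≈ ι-lower (ι-* (+ 2) w) (ι-mono lower))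
    (≤-resp-≈ refl ι-upper (ι-mono upper))
    where
    ι-lower : ι ((+ 2 ℤ.* v ℤ.+ + 1) ℤ.* (a ℤ.+ + 2) ℤ.+ + 1) ≈ (2# * ι v + 1#) * (ι a + 2#) + 1#
    ι-lower = trans (ι-+1 ((+ 2 ℤ.* v ℤ.+ + 1) ℤ.* (a ℤ.+ + 2)))
                (+-congʳ (trans (ι-* (+ 2 ℤ.* v ℤ.+ + 1) (a ℤ.+ + 2))
                  (*-cong (trans (ι-+1 (+ 2 ℤ.* v)) (+-congʳ (ι-* (+ 2) v))) (ι-+ a (+ 2)))))
    ι-upper : ι ((v ℤ.+ + 1) ℤ.* (a ℤ.+ + 1)) ≈ (ι v + 1#) * (ι a + 1#)
    ι-upper = trans (ι-* (v ℤ.+ + 1) (a ℤ.+ + 1)) (*-cong (ι-+1 v) (ι-+1 a))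

open import Data.Integer using (_+_; _*_; _-_; _≤_)

proposition5p6 : ∀ {c ℓ₁ ℓ₂ : Level} (a v w : ℤ) →
    -[1+ 0 ] ≤ a →
    + 0 ≤ v → + 2 * v ≤ a - + 1 →
    (+ 2 * v + + 1) * (a + + 2) + + 1 ≤ + 2 * w →
    w ≤ (v + + 1) * (a + + 1) →
    (F : OrderedField c ℓ₁ ℓ₂) (r : OrderedField.Carrier F) →
    OrderedField._≈_ F (fPoly F a r) (OrderedField.0# F) →
    OrderedField._<_ F (OrderedField.0# F) (twoαMinus1 F v w r)
proposition5p6 a v w _ 0≤v 2v≤a-1 lower upper F r root =
  Proposition.2α-1-pos-ℤ F a v w 0≤v 2v≤a-1 lower upper root
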